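{- Let $k\ge 1$ and let $L=(l_1,\ldots,l_k)$ be a sequence of positive integers, and let $S=S(L)$ be the spider with head $v_0$ and legs $S_i=v_0,v_{i,1},\ldots,v_{i,l_i}$ for $1\le i\le k$. Let $t$ be an integer with $t\le \alpha(S)$. Then for every $1\le i\le k$ we have $$|\mathcal{I}^t_{v_0}(S)|\le |\mathcal{I}^t_{v_{i,l_i}}(S)|.$$
   Context: For a sequence of positive integers $L=(l_1,\ldots,l_k)$, the spider $S=S(L)$ is the tree consisting of a vertex $v_0$ (the head) together with, for each $1\le i\le k$, a path (leg) $S_i=v_0,v_{i,1},\ldots,v_{i,l_i}$, the legs sharing only $v_0$. For a graph $G$, $\alpha(G)$ denotes the maximum size of an independent set in $G$; for an integer $t\le\alpha(G)$, $\mathcal{I}^t(G)$ is the family of all independent sets of $G$ of size $t$, and for a vertex $x$, $\mathcal{I}^t_x(G)$ (the star centered at $x$) is the subfamily of those sets in $\mathcal{I}^t(G)$ that contain $x$. -}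

module Defs where

open import Data.Bool using (Bool; true; false; _∧_; not)
open import Data.Nat using (ℕ; zero; suc; _+_; _≡ᵇ_; _⊔_)
open import Data.Nat.ListAction using (sum)
open import Data.List using (List; []; _∷_; _++_; [_]; map; length; filterᵇ; foldr; take)
open import Data.Vec using (Vec; []; _∷_)
open import Data.Fin using (Fin; toℕ)
open import Data.Fin.Subset using (Subset; ∣_∣)
open import Data.Product using (_×_; _,_)

-- Finite graphs: vertex set {0,…,n-1}, given by a list of edges
-- (unordered pairs of vertex indices, stored as ordered pairs of ℕ).

record Graph : Set where
  constructor graph
  field
    order : ℕ
    edges : List (ℕ × ℕ)

open Graph public

memℕ : {n : ℕ} → ℕ → Subset n → Bool
memℕ u       []      = false
memℕ zero    (b ∷ _) = b
memℕ (suc u) (_ ∷ p) = memℕ u p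

allᵇ : {A : Set} → (A → Bool) → List A → Bool
allᵇ p []       = true
allᵇ p (x ∷ xs) = p x ∧ allᵇ p xs

isIndependent : (G : Graph) → Subset (order G) → Bool
isIndependent G S = allᵇ (λ { (u , v) → not (memℕ u S ∧ memℕ v S) }) (edges G)

allSubsets : (n : ℕ) → List (Subset n)
allSubsets zero    = [ [] ]
allSubsets (suc n) = map (true ∷_) (allSubsets n) ++ map (false ∷_) (allSubsets n)

independentSets : (G : Graph) → List (Subset (order G))
independentSets G = filterᵇ (isIndependent G) (allSubsets (order G))

α : Graph → ℕ
α G = foldr (λ S m → ∣ S ∣ ⊔ m) 0 (independentSets G)

𝓘 : (G : Graph) → ℕ → List (Subset (order G))
𝓘 G t = filterᵇ (λ S → ∣ S ∣ ≡ᵇ t) (independentSets G)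

𝓘[_]_at_ : (G : Graph) → ℕ → Fin (order G) → List (Subset (order G))
𝓘[ G ] t at x = filterᵇ (memℕ (toℕ x)) (𝓘 G t)

-- Spiders.  For L = (l₁,…,l_k), the head v₀ has index 0, and leg i
-- (0-based) occupies the consecutive indices
--   1 + (l₁+…+l_i) , … , l₁+…+l_{i+1}
-- in the order v_{i,1}, …, v_{i,l_i}.

pathEdges : ℕ → ℕ → List (ℕ × ℕ)
pathEdges s zero    = []
pathEdges s (suc l) = (s , suc s) ∷ pathEdges (suc s) l

legEdges : ℕ → ℕ → List (ℕ × ℕ)
legEdges s zero    = []
legEdges s (suc l) = (0 , s) ∷ pathEdges s l

spiderEdgesFrom : ℕ → List ℕ → List (ℕ × ℕ)
spiderEdgesFrom s []      = []
spiderEdgesFrom s (l ∷ L) = legEdges s l ++ spiderEdgesFrom (s + l) L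

spider : List ℕ → Graph
spider L = graph (suc (sum L)) (spiderEdgesFrom 1 L)

spiderHead : (L : List ℕ) → Fin (order (spider L))
spiderHead L = Fin.zero
  where import Data.Fin as Fin

-- index of the last vertex v_{i,l_i} of leg i (0-based i)
legEndIndex : List ℕ → ℕ → ℕ
legEndIndex L i = sum (take (suc i) L)

module Submission where

-- Fix a leg S_i = v₀, v_{i,1}, …, v_{i,l} of the spider.  The
-- path v₀ … v_{i,l} reversed end to end is again a path, so the map ρ that swaps
-- the membership bits along it (v₀ ↔ v_{i,l}, v_{i,j} ↔ v_{i,l-j}) and fixes every
-- other vertex is an involution on vertex sets preserving their size.  If S is
-- independent and contains v₀, then every other leg avoids the neighbours of v₀,
-- so those legs stay independent whatever the new head bit is, while the reflected
-- path is independent by symmetry; and ρ(S) contains v_{i,l}.  Hence ρ injects the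
-- star at v₀ into the star at v_{i,l}, which is the theorem.

open import Defs
open import Algebra.Properties.CommutativeSemigroup using (x∙yz≈yx∙z; interchange)
open import Data.Bool using (Bool; true; false; _∧_; not; T)
open import Data.Bool.Properties using (∧-assoc; ∧-comm; ∧-identityʳ; ∧-zeroʳ; T-∧)
open import Data.Empty using (⊥-elim)
open import Data.Fin as Fin using (Fin; toℕ)
open import Data.Fin.Subset using (Subset; ∣_∣)
open import Data.List using (List; []; _∷_; _++_; [_]; _ʳ++_; map; length; take; drop; reverse; lookup)
open import Data.List.Membership.Propositional using (_∈_)
open import Data.List.Membership.Propositional.Properties
  using (∈-filter⁺; ∈-filter⁻; ∈-map⁺; ∈-map⁻; ∈-++⁺ˡ; ∈-++⁺ʳ; ∈-++⁻; ∈-∃++; ∈-lookup)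
open import Data.List.Properties using (++-assoc; length-++; length-++-sucʳ; length-map; length-reverse; unfold-reverse; reverse-involutive; take-suc)
open import Data.List.Relation.Binary.Subset.Propositional using (_⊆_)
open import Data.List.Relation.Unary.All as All using (All; []; _∷_)
open import Data.List.Relation.Unary.AllPairs using ([]; _∷_)
open import Data.List.Relation.Unary.Any using (here; there)
open import Data.List.Relation.Unary.Unique.Propositional using (Unique)
import Data.List.Relation.Unary.Unique.Propositional.Properties as Unique
open import Data.Nat using (ℕ; zero; suc; _+_; _≤_; _<_; _≡ᵇ_; z≤n; s≤s)
open import Data.Nat.ListAction using (sum)
open import Data.Nat.ListAction.Properties using (sum-++)
open import Data.Nat.Properties using (+-identityʳ; +-suc; +-assoc; suc-injective; ≤-reflexive; ≡ᵇ⇒≡; ≡⇒≡ᵇ; +-commutativeSemigroup)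
open import Data.Product using (_×_; _,_; ∃₂; proj₁; proj₂)
open import Data.Sum using (inj₁; inj₂)
open import Data.Vec using (toList; fromList; cast) renaming ([] to []ᵛ; _∷_ to _∷ᵛ_)
open import Data.Vec.Properties using (length-toList; toList∘fromList; toList-cast; toList-injective; cast-is-id; ∷-injectiveʳ)
open import Function using (_∘_)
open import Function.Bundles using (Equivalence)
open import Relation.Binary.PropositionalEquality using (_≡_; refl; sym; trans; cong; cong₂; subst; module ≡-Reasoning)
open import Relation.Nullary using (¬_)
open import Relation.Nullary.Decidable using (T?)

open ≡-Reasoning

unique-⊆⇒length-≤ : ∀ {A : Set} {as bs : List A} → Unique as → as ⊆ bs → length as ≤ length bs
unique-⊆⇒length-≤ {as = []} _ _ = z≤n
unique-⊆⇒length-≤ {as = x ∷ as} (x∉as ∷ unique) as⊆bs with ∈-∃++ (as⊆bs (here refl))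
... | bs₁ , bs₂ , refl =
  subst (suc (length as) ≤_) (sym (length-++-sucʳ bs₁ x bs₂))
    (s≤s (unique-⊆⇒length-≤ unique as⊆bs₁++bs₂))
  where
  as⊆bs₁++bs₂ : as ⊆ bs₁ ++ bs₂
  as⊆bs₁++bs₂ y∈as with ∈-++⁻ bs₁ (as⊆bs (there y∈as))
  ... | inj₁ y∈bs₁         = ∈-++⁺ˡ y∈bs₁
  ... | inj₂ (here refl)   = ⊥-elim (All.lookup x∉as y∈as refl)
  ... | inj₂ (there y∈bs₂) = ∈-++⁺ʳ bs₁ y∈bs₂

allSubsets-complete : ∀ {n} (S : Subset n) → S ∈ allSubsets n
allSubsets-complete []ᵛ = here refl
allSubsets-complete (true ∷ᵛ S) = ∈-++⁺ˡ (∈-map⁺ (true ∷ᵛ_) (allSubsets-complete S))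
allSubsets-complete {suc n} (false ∷ᵛ S) =
  ∈-++⁺ʳ (map (true ∷ᵛ_) (allSubsets n)) (∈-map⁺ (false ∷ᵛ_) (allSubsets-complete S))

allSubsets-unique : ∀ n → Unique (allSubsets n)
allSubsets-unique zero = [] ∷ []
allSubsets-unique (suc n) =
  Unique.++⁺ (Unique.map⁺ ∷-injectiveʳ (allSubsets-unique n))
             (Unique.map⁺ ∷-injectiveʳ (allSubsets-unique n)) disjoint
  where
  disjoint : ∀ {S} → ¬ (S ∈ map (true ∷ᵛ_) (allSubsets n) × S ∈ map (false ∷ᵛ_) (allSubsets n))
  disjoint (S∈₁ , S∈₂) with ∈-map⁻ (true ∷ᵛ_) S∈₁ | ∈-map⁻ (false ∷ᵛ_) S∈₂
  ... | _ , _ , refl | _ , _ , ()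

module _ {G : Graph} {t : ℕ} {x : Fin (order G)} where

  ∈-star⁻ : ∀ {S} → S ∈ 𝓘[ G ] t at x →
    T (isIndependent G S) × ∣ S ∣ ≡ t × T (memℕ (toℕ x) S)
  ∈-star⁻ S∈ =
    let (S∈𝓘 , x∈S) = ∈-filter⁻ (T? ∘ memℕ (toℕ x)) {xs = 𝓘 G t} S∈
        (S∈ind , size) = ∈-filter⁻ (T? ∘ λ S → ∣ S ∣ ≡ᵇ t) {xs = independentSets G} S∈𝓘
        (_ , indep) = ∈-filter⁻ (T? ∘ isIndependent G) {xs = allSubsets (order G)} S∈ind
    in indep , ≡ᵇ⇒≡ _ _ size , x∈S

  ∈-star⁺ : ∀ {S} → T (isIndependent G S) → ∣ S ∣ ≡ t → T (memℕ (toℕ x) S) →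
    S ∈ 𝓘[ G ] t at x
  ∈-star⁺ {S} indep size x∈S =
    ∈-filter⁺ (T? ∘ memℕ (toℕ x))
      (∈-filter⁺ (T? ∘ λ S → ∣ S ∣ ≡ᵇ t)
        (∈-filter⁺ (T? ∘ isIndependent G) (allSubsets-complete S) indep)
        (≡⇒≡ᵇ _ _ size))
      x∈S

  star-unique : Unique (𝓘[ G ] t at x)
  star-unique = Unique.filter⁺ _ (Unique.filter⁺ _ (Unique.filter⁺ _ (allSubsets-unique (order G))))

star-≤ : ∀ (G : Graph) t (x y : Fin (order G)) (ρ : Subset (order G) → Subset (order G)) →
  (∀ {S S′} → ρ S ≡ ρ S′ → S ≡ S′) →
  (∀ S → T (isIndependent G S) → T (memℕ (toℕ x) S) →
    T (isIndependent G (ρ S)) × ∣ ρ S ∣ ≡ ∣ S ∣ × T (memℕ (toℕ y) (ρ S))) →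
  length (𝓘[ G ] t at x) ≤ length (𝓘[ G ] t at y)
star-≤ G t x y ρ ρ-injective ρ-star =
  subst (_≤ length (𝓘[ G ] t at y)) (length-map ρ (𝓘[ G ] t at x))
    (unique-⊆⇒length-≤ (Unique.map⁺ ρ-injective (star-unique {G} {t} {x})) image⊆star)
  where
  image⊆star : map ρ (𝓘[ G ] t at x) ⊆ 𝓘[ G ] t at y
  image⊆star ρS∈ with ∈-map⁻ ρ ρS∈
  ... | S , S∈ , refl =
    let (indep , size , x∈S) = ∈-star⁻ {G} {t} {x} S∈
        (indep′ , size′ , y∈ρS) = ρ-star S indep x∈S
    in ∈-star⁺ {G} {t} {y} indep′ (trans size′ size) y∈ρS

-- Vertex sets as bit lists.

-- the bit at position u (false beyond the end)
at : List Bool → ℕ → Bool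
at []       _       = false
at (b ∷ _)  zero    = b
at (_ ∷ bs) (suc u) = at bs u

at-++ : ∀ (a b : List Bool) k → at (a ++ b) (length a + k) ≡ at b k
at-++ []      b k = refl
at-++ (_ ∷ a) b k = at-++ a b k

at-++ˡ : ∀ (a b : List Bool) {k} → k < length a → at (a ++ b) k ≡ at a k
at-++ˡ (_ ∷ a) b {zero}  _         = refl
at-++ˡ (_ ∷ a) b {suc k} (s≤s k<) = at-++ˡ a b k<

at-++-length : ∀ (a b : List Bool) → at (a ++ b) (length a) ≡ at b 0
at-++-length a b = trans (cong (at (a ++ b)) (sym (+-identityʳ (length a)))) (at-++ a b 0)

at-reverse-last : ∀ h (w : List Bool) → at (reverse (h ∷ w)) (length w) ≡ h
at-reverse-last h w = begin
  at (reverse (h ∷ w)) (length w)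
    ≡⟨ cong (at (reverse (h ∷ w))) (sym (length-reverse w)) ⟩
  at (reverse (h ∷ w)) (length (reverse w))
    ≡⟨ cong (λ r → at r (length (reverse w))) (unfold-reverse h w) ⟩
  at (reverse w ++ [ h ]) (length (reverse w))
    ≡⟨ at-++-length (reverse w) [ h ] ⟩
  h ∎

take-length-++ : ∀ {A : Set} (a b : List A) → take (length a) (a ++ b) ≡ a
take-length-++ []      b = refl
take-length-++ (x ∷ a) b = cong (x ∷_) (take-length-++ a b)

drop-length-++ : ∀ {A : Set} (a b : List A) → drop (length a) (a ++ b) ≡ b
drop-length-++ []      b = refl
drop-length-++ (_ ∷ a) b = drop-length-++ a b

split-length : ∀ {A : Set} m n (xs : List A) → length xs ≡ m + n →
  ∃₂ λ ys zs → xs ≡ ys ++ zs × length ys ≡ m × length zs ≡ n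
split-length zero    n xs       len = [] , xs , refl , refl , len
split-length (suc m) n (x ∷ xs) len with split-length m n xs (suc-injective len)
... | ys , zs , refl , len-ys , len-zs = x ∷ ys , zs , refl , cong suc len-ys , len-zs

bit : Bool → ℕ
bit true  = 1
bit false = 0

trues : List Bool → ℕ
trues []       = 0
trues (b ∷ bs) = bit b + trues bs

trues-++ : ∀ a b → trues (a ++ b) ≡ trues a + trues b
trues-++ []      b = refl
trues-++ (x ∷ a) b = trans (cong (bit x +_) (trues-++ a b)) (sym (+-assoc (bit x) (trues a) (trues b)))

-- Counting is invariant under reversal; stated for reverse-append so that induction goes through.
trues-ʳ++ : ∀ a b → trues (a ʳ++ b) ≡ trues a + trues b
trues-ʳ++ []      b = refl
trues-ʳ++ (x ∷ a) b =
  trans (trues-ʳ++ a (x ∷ b)) (x∙yz≈yx∙z +-commutativeSemigroup (trues a) (bit x) (trues b))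

trues-reverse : ∀ a → trues (reverse a) ≡ trues a
trues-reverse a = trans (trues-ʳ++ a []) (+-identityʳ (trues a))

memℕ-toList : ∀ {n} u (S : Subset n) → memℕ u S ≡ at (toList S) u
memℕ-toList u       []ᵛ      = refl
memℕ-toList zero    (_ ∷ᵛ S) = refl
memℕ-toList (suc u) (_ ∷ᵛ S) = memℕ-toList u S

∣∣-toList : ∀ {n} (S : Subset n) → ∣ S ∣ ≡ trues (toList S)
∣∣-toList []ᵛ          = refl
∣∣-toList (true ∷ᵛ S)  = cong suc (∣∣-toList S)
∣∣-toList (false ∷ᵛ S) = ∣∣-toList S

toList-injective′ : ∀ {n} {S S′ : Subset n} → toList S ≡ toList S′ → S ≡ S′
toList-injective′ {S = S} {S′} eq = trans (sym (cast-is-id refl S)) (toList-injective refl S S′ eq)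

edgeFree : (ℕ → Bool) → ℕ × ℕ → Bool
edgeFree f (u , v) = not (f u ∧ f v)

edgesIndep : (ℕ → Bool) → List (ℕ × ℕ) → Bool
edgesIndep f = allᵇ (edgeFree f)

allᵇ-++ : ∀ {A : Set} (p : A → Bool) xs ys → allᵇ p (xs ++ ys) ≡ allᵇ p xs ∧ allᵇ p ys
allᵇ-++ p []       ys = refl
allᵇ-++ p (x ∷ xs) ys = trans (cong (p x ∧_) (allᵇ-++ p xs ys)) (sym (∧-assoc (p x) _ _))

allᵇ-cong : ∀ {A : Set} {p q : A → Bool} → (∀ x → p x ≡ q x) → ∀ xs → allᵇ p xs ≡ allᵇ q xs
allᵇ-cong p≡q []       = refl
allᵇ-cong p≡q (x ∷ xs) = cong₂ _∧_ (p≡q x) (allᵇ-cong p≡q xs)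

isIndependent-toList : ∀ G (S : Subset (order G)) →
  isIndependent G S ≡ edgesIndep (at (toList S)) (edges G)
isIndependent-toList G S =
  allᵇ-cong (λ { (u , v) → cong₂ (λ a b → not (a ∧ b)) (memℕ-toList u S) (memℕ-toList v S) }) (edges G)

pathIndep : List Bool → Bool
pathIndep (x ∷ y ∷ r) = not (x ∧ y) ∧ pathIndep (y ∷ r)
pathIndep _           = true

pathIndep-∷-take : ∀ h v l → pathIndep (h ∷ take (suc l) v) ≡ not (h ∧ at v 0) ∧ pathIndep (take (suc l) v)
pathIndep-∷-take h []      l = sym (cong (λ b → not b ∧ true) (∧-zeroʳ h))
pathIndep-∷-take h (_ ∷ _) l = refl

pathIndep-ʳ++ : ∀ xs x ys → pathIndep (xs ʳ++ x ∷ ys) ≡ pathIndep (x ∷ xs) ∧ pathIndep (x ∷ ys)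
pathIndep-ʳ++ []       x ys = refl
pathIndep-ʳ++ (y ∷ xs) x ys = begin
  pathIndep (xs ʳ++ y ∷ x ∷ ys)
    ≡⟨ pathIndep-ʳ++ xs y (x ∷ ys) ⟩
  pathIndep (y ∷ xs) ∧ (not (y ∧ x) ∧ pathIndep (x ∷ ys))
    ≡⟨ cong (λ b → pathIndep (y ∷ xs) ∧ (not b ∧ pathIndep (x ∷ ys))) (∧-comm y x) ⟩
  pathIndep (y ∷ xs) ∧ (not (x ∧ y) ∧ pathIndep (x ∷ ys))
    ≡⟨ sym (∧-assoc (pathIndep (y ∷ xs)) _ _) ⟩
  (pathIndep (y ∷ xs) ∧ not (x ∧ y)) ∧ pathIndep (x ∷ ys)
    ≡⟨ cong (_∧ pathIndep (x ∷ ys)) (∧-comm (pathIndep (y ∷ xs)) _) ⟩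
  (not (x ∧ y) ∧ pathIndep (y ∷ xs)) ∧ pathIndep (x ∷ ys) ∎

pathIndep-reverse : ∀ xs → pathIndep (reverse xs) ≡ pathIndep xs
pathIndep-reverse []       = refl
pathIndep-reverse (x ∷ xs) = trans (pathIndep-ʳ++ xs x []) (∧-identityʳ (pathIndep (x ∷ xs)))

pathIndep-head-mono : ∀ b w → T (pathIndep (true ∷ w)) → T (pathIndep (b ∷ w))
pathIndep-head-mono true  w       indep = indep
pathIndep-head-mono false []      _     = _
pathIndep-head-mono false (y ∷ w) indep = proj₂ (Equivalence.to (T-∧ {not y}) indep)

pathEdges-shift : ∀ f s l → edgesIndep f (pathEdges (suc s) l) ≡ edgesIndep (f ∘ suc) (pathEdges s l)
pathEdges-shift f s zero    = refl
pathEdges-shift f s (suc l) = cong (edgeFree f (suc s , suc (suc s)) ∧_) (pathEdges-shift f (suc s) l)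

pathEdges-from-0 : ∀ v l → edgesIndep (at v) (pathEdges 0 l) ≡ pathIndep (take (suc l) v)
pathEdges-from-0 []      zero    = refl
pathEdges-from-0 (_ ∷ _) zero    = refl
pathEdges-from-0 []      (suc l) = trans (pathEdges-shift (at []) 0 l) (pathEdges-from-0 [] l)
pathEdges-from-0 (y ∷ v) (suc l) = begin
  not (y ∧ at v 0) ∧ edgesIndep (at (y ∷ v)) (pathEdges 1 l)
    ≡⟨ cong (not (y ∧ at v 0) ∧_) (trans (pathEdges-shift (at (y ∷ v)) 0 l) (pathEdges-from-0 v l)) ⟩
  not (y ∧ at v 0) ∧ pathIndep (take (suc l) v)
    ≡⟨ sym (pathIndep-∷-take y v l) ⟩
  pathIndep (y ∷ take (suc l) v) ∎

pathEdges-indep : ∀ pre v l → edgesIndep (at (pre ++ v)) (pathEdges (length pre) l) ≡ pathIndep (take (suc l) v)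
pathEdges-indep []        v l = pathEdges-from-0 v l
pathEdges-indep (x ∷ pre) v l = trans (pathEdges-shift (at (x ∷ pre ++ v)) (length pre) l) (pathEdges-indep pre v l)

legEdges-indep : ∀ h pre v l →
  edgesIndep (at (h ∷ pre ++ v)) (legEdges (suc (length pre)) l) ≡ pathIndep (h ∷ take l v)
legEdges-indep h pre v zero    = refl
legEdges-indep h pre v (suc l) = begin
  not (h ∧ at (pre ++ v) (length pre)) ∧ edgesIndep (at (h ∷ pre ++ v)) (pathEdges (suc (length pre)) l)
    ≡⟨ cong₂ (λ b c → not (h ∧ b) ∧ c) (at-++-length pre v) (pathEdges-shift (at (h ∷ pre ++ v)) (length pre) l) ⟩
  not (h ∧ at v 0) ∧ edgesIndep (at (pre ++ v)) (pathEdges (length pre) l)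
    ≡⟨ cong (not (h ∧ at v 0) ∧_) (pathEdges-indep pre v l) ⟩
  not (h ∧ at v 0) ∧ pathIndep (take (suc l) v)
    ≡⟨ sym (pathIndep-∷-take h v l) ⟩
  pathIndep (h ∷ take (suc l) v) ∎

-- Independence of a spider, leg by leg.

legsIndep : Bool → List ℕ → List Bool → Bool
legsIndep h []      v = true
legsIndep h (l ∷ L) v = pathIndep (h ∷ take l v) ∧ legsIndep h L (drop l v)

spiderEdges-indep : ∀ h L pre v → length v ≡ sum L →
  edgesIndep (at (h ∷ pre ++ v)) (spiderEdgesFrom (suc (length pre)) L) ≡ legsIndep h L v
spiderEdges-indep h []      pre v _   = refl
spiderEdges-indep h (l ∷ L) pre v len with split-length l (sum L) v len
... | a , b , refl , refl , len-b = begin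
  edgesIndep F (legEdges (suc (length pre)) (length a) ++ spiderEdgesFrom (suc (length pre + length a)) L)
    ≡⟨ allᵇ-++ (edgeFree F) (legEdges (suc (length pre)) (length a)) _ ⟩
  edgesIndep F (legEdges (suc (length pre)) (length a)) ∧ edgesIndep F (spiderEdgesFrom (suc (length pre + length a)) L)
    ≡⟨ cong₂ _∧_ (legEdges-indep h pre (a ++ b) (length a)) later-legs ⟩
  pathIndep (h ∷ take (length a) (a ++ b)) ∧ legsIndep h L (drop (length a) (a ++ b)) ∎
  where
  F = at (h ∷ pre ++ a ++ b)
  later-legs : edgesIndep F (spiderEdgesFrom (suc (length pre + length a)) L) ≡ legsIndep h L (drop (length a) (a ++ b))
  later-legs = begin
    edgesIndep F (spiderEdgesFrom (suc (length pre + length a)) L)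
      ≡⟨ cong₂ (λ xs k → edgesIndep (at (h ∷ xs)) (spiderEdgesFrom (suc k) L)) (sym (++-assoc pre a b)) (sym (length-++ pre)) ⟩
    edgesIndep (at (h ∷ (pre ++ a) ++ b)) (spiderEdgesFrom (suc (length (pre ++ a))) L)
      ≡⟨ spiderEdges-indep h L (pre ++ a) b len-b ⟩
    legsIndep h L b
      ≡⟨ cong (legsIndep h L) (sym (drop-length-++ a b)) ⟩
    legsIndep h L (drop (length a) (a ++ b)) ∎

legsIndep-++ : ∀ h L₁ L₂ v₁ v₂ → length v₁ ≡ sum L₁ →
  legsIndep h (L₁ ++ L₂) (v₁ ++ v₂) ≡ legsIndep h L₁ v₁ ∧ legsIndep h L₂ v₂
legsIndep-++ h []       L₂ []       v₂ _   = refl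
legsIndep-++ h (l ∷ L₁) L₂ v₁       v₂ len with split-length l (sum L₁) v₁ len
... | a , b , refl , refl , len-b
  rewrite ++-assoc a b v₂ | take-length-++ a (b ++ v₂) | drop-length-++ a (b ++ v₂)
        | take-length-++ a b | drop-length-++ a b =
  trans (cong (pathIndep (h ∷ a) ∧_) (legsIndep-++ h L₁ L₂ b v₂ len-b)) (sym (∧-assoc (pathIndep (h ∷ a)) _ _))

legsIndep-head-mono : ∀ b L v → T (legsIndep true L v) → T (legsIndep b L v)
legsIndep-head-mono b []      v _     = _
legsIndep-head-mono b (l ∷ L) v indep =
  let (first , rest) = Equivalence.to (T-∧ {pathIndep (true ∷ take l v)}) indep
  in Equivalence.from T-∧ (pathIndep-head-mono b (take l v) first , legsIndep-head-mono b L (drop l v) rest)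

spider-indep-split : ∀ L₁ l L₂ h v₁ w v₂ → length v₁ ≡ sum L₁ → length w ≡ l → length v₂ ≡ sum L₂ →
  edgesIndep (at (h ∷ v₁ ++ w ++ v₂)) (spiderEdgesFrom 1 (L₁ ++ l ∷ L₂))
    ≡ legsIndep h L₁ v₁ ∧ (pathIndep (h ∷ w) ∧ legsIndep h L₂ v₂)
spider-indep-split L₁ _ L₂ h v₁ w v₂ len₁ refl len₂ = begin
  edgesIndep (at (h ∷ v₁ ++ w ++ v₂)) (spiderEdgesFrom 1 (L₁ ++ length w ∷ L₂))
    ≡⟨ spiderEdges-indep h (L₁ ++ length w ∷ L₂) [] (v₁ ++ w ++ v₂) len ⟩
  legsIndep h (L₁ ++ length w ∷ L₂) (v₁ ++ w ++ v₂)
    ≡⟨ legsIndep-++ h L₁ (length w ∷ L₂) v₁ (w ++ v₂) len₁ ⟩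
  legsIndep h L₁ v₁ ∧ (pathIndep (h ∷ take (length w) (w ++ v₂)) ∧ legsIndep h L₂ (drop (length w) (w ++ v₂)))
    ≡⟨ cong₂ (λ a b → legsIndep h L₁ v₁ ∧ (pathIndep (h ∷ a) ∧ legsIndep h L₂ b)) (take-length-++ w v₂) (drop-length-++ w v₂) ⟩
  legsIndep h L₁ v₁ ∧ (pathIndep (h ∷ w) ∧ legsIndep h L₂ v₂) ∎
  where
  len : length (v₁ ++ w ++ v₂) ≡ sum (L₁ ++ length w ∷ L₂)
  len = trans (length-++ v₁) (trans (cong₂ _+_ len₁ (trans (length-++ w) (cong (length w +_) len₂)))
          (sym (sum-++ L₁ (length w ∷ L₂))))

-- Reflecting one leg.

-- The bit list whose head bit and distinguished-leg bits form the path p, and whose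
-- remaining leg bits are v₁ (before) and v₂ (after).
withLeg : List Bool → List Bool → List Bool → List Bool
withLeg []      v₁ v₂ = v₁ ++ v₂
withLeg (h ∷ w) v₁ v₂ = h ∷ v₁ ++ w ++ v₂

reflectLeg : ℕ → ℕ → List Bool → List Bool
reflectLeg P l []      = []
reflectLeg P l (h ∷ v) = withLeg (reverse (h ∷ take l (drop P v))) (take P v) (drop l (drop P v))

data LegSplit (P l m : ℕ) : List Bool → Set where
  legSplit : ∀ p v₁ v₂ → length v₁ ≡ P → length p ≡ suc l → length v₂ ≡ m → LegSplit P l m (withLeg p v₁ v₂)

legSplit? : ∀ P l m xs → length xs ≡ suc (P + (l + m)) → LegSplit P l m xs
legSplit? P l m (h ∷ v) len with split-length P (l + m) v (suc-injective len)
... | v₁ , r , refl , len₁ , len-r with split-length l m r len-r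
...   | w , v₂ , refl , len-w , len₂ = legSplit (h ∷ w) v₁ v₂ len₁ (cong suc len-w) len₂

reflectLeg-withLeg : ∀ p v₁ v₂ {l} → length p ≡ suc l →
  reflectLeg (length v₁) l (withLeg p v₁ v₂) ≡ withLeg (reverse p) v₁ v₂
reflectLeg-withLeg (h ∷ w) v₁ v₂ refl
  rewrite take-length-++ v₁ (w ++ v₂) | drop-length-++ v₁ (w ++ v₂)
        | take-length-++ w v₂ | drop-length-++ w v₂ = refl

length-withLeg : ∀ p v₁ v₂ → length (withLeg p v₁ v₂) ≡ length p + (length v₁ + length v₂)
length-withLeg []      v₁ v₂ = length-++ v₁
length-withLeg (h ∷ w) v₁ v₂ = cong suc (begin
  length (v₁ ++ w ++ v₂)                    ≡⟨ length-++ v₁ ⟩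
  length v₁ + length (w ++ v₂)              ≡⟨ cong (length v₁ +_) (length-++ w) ⟩
  length v₁ + (length w + length v₂)        ≡⟨ x∙yz≈yx∙z +-commutativeSemigroup (length v₁) (length w) (length v₂) ⟩
  (length w + length v₁) + length v₂        ≡⟨ +-assoc (length w) (length v₁) (length v₂) ⟩
  length w + (length v₁ + length v₂)        ∎)

trues-withLeg : ∀ p v₁ v₂ → trues (withLeg p v₁ v₂) ≡ trues p + (trues v₁ + trues v₂)
trues-withLeg []      v₁ v₂ = trues-++ v₁ v₂
trues-withLeg (h ∷ w) v₁ v₂ = begin
  bit h + trues (v₁ ++ w ++ v₂)                  ≡⟨ cong (bit h +_) (trans (trues-++ v₁ (w ++ v₂)) (cong (trues v₁ +_) (trues-++ w v₂))) ⟩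
  bit h + (trues v₁ + (trues w + trues v₂))      ≡⟨ sym (+-assoc (bit h) (trues v₁) _) ⟩
  (bit h + trues v₁) + (trues w + trues v₂)      ≡⟨ interchange +-commutativeSemigroup (bit h) (trues v₁) (trues w) (trues v₂) ⟩
  (bit h + trues w) + (trues v₁ + trues v₂)      ∎

withLeg-at : ∀ p v₁ v₂ k → 0 < k → k < length p → at (withLeg p v₁ v₂) (length v₁ + k) ≡ at p k
withLeg-at (x ∷ w) v₁ v₂ (suc j) _ (s≤s j<) = begin
  at (x ∷ v₁ ++ w ++ v₂) (length v₁ + suc j)   ≡⟨ cong (at (x ∷ v₁ ++ w ++ v₂)) (+-suc (length v₁) j) ⟩
  at (v₁ ++ w ++ v₂) (length v₁ + j)           ≡⟨ at-++ v₁ (w ++ v₂) j ⟩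
  at (w ++ v₂) j                               ≡⟨ at-++ˡ w v₂ j< ⟩
  at w j                                       ∎

module _ {P l m : ℕ} where

  reflectLeg-length : ∀ {xs} → LegSplit P l m xs → length (reflectLeg P l xs) ≡ length xs
  reflectLeg-length (legSplit p v₁ v₂ refl len-p _) = begin
    length (reflectLeg (length v₁) l (withLeg p v₁ v₂))   ≡⟨ cong length (reflectLeg-withLeg p v₁ v₂ len-p) ⟩
    length (withLeg (reverse p) v₁ v₂)                    ≡⟨ length-withLeg (reverse p) v₁ v₂ ⟩
    length (reverse p) + (length v₁ + length v₂)          ≡⟨ cong (_+ (length v₁ + length v₂)) (length-reverse p) ⟩
    length p + (length v₁ + length v₂)                    ≡⟨ sym (length-withLeg p v₁ v₂) ⟩
    length (withLeg p v₁ v₂)                              ∎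

  reflectLeg-involutive : ∀ {xs} → LegSplit P l m xs → reflectLeg P l (reflectLeg P l xs) ≡ xs
  reflectLeg-involutive (legSplit p v₁ v₂ refl len-p _) = begin
    reflectLeg (length v₁) l (reflectLeg (length v₁) l (withLeg p v₁ v₂))
      ≡⟨ cong (reflectLeg (length v₁) l) (reflectLeg-withLeg p v₁ v₂ len-p) ⟩
    reflectLeg (length v₁) l (withLeg (reverse p) v₁ v₂)
      ≡⟨ reflectLeg-withLeg (reverse p) v₁ v₂ (trans (length-reverse p) len-p) ⟩
    withLeg (reverse (reverse p)) v₁ v₂
      ≡⟨ cong (λ q → withLeg q v₁ v₂) (reverse-involutive p) ⟩
    withLeg p v₁ v₂ ∎

  reflectLeg-trues : ∀ {xs} → LegSplit P l m xs → trues (reflectLeg P l xs) ≡ trues xs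
  reflectLeg-trues (legSplit p v₁ v₂ refl len-p _) = begin
    trues (reflectLeg (length v₁) l (withLeg p v₁ v₂))   ≡⟨ cong trues (reflectLeg-withLeg p v₁ v₂ len-p) ⟩
    trues (withLeg (reverse p) v₁ v₂)                    ≡⟨ trues-withLeg (reverse p) v₁ v₂ ⟩
    trues (reverse p) + (trues v₁ + trues v₂)            ≡⟨ cong (_+ (trues v₁ + trues v₂)) (trues-reverse p) ⟩
    trues p + (trues v₁ + trues v₂)                      ≡⟨ sym (trues-withLeg p v₁ v₂) ⟩
    trues (withLeg p v₁ v₂)                              ∎

  reflectLeg-end : ∀ {xs} → LegSplit P l m xs → 0 < l → at (reflectLeg P l xs) (P + l) ≡ at xs 0
  reflectLeg-end (legSplit (h ∷ w) v₁ v₂ refl refl _) 0<l = begin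
    at (reflectLeg (length v₁) (length w) (withLeg (h ∷ w) v₁ v₂)) (length v₁ + length w)
      ≡⟨ cong (λ r → at r (length v₁ + length w)) (reflectLeg-withLeg (h ∷ w) v₁ v₂ refl) ⟩
    at (withLeg (reverse (h ∷ w)) v₁ v₂) (length v₁ + length w)
      ≡⟨ withLeg-at (reverse (h ∷ w)) v₁ v₂ (length w) 0<l (≤-reflexive (sym (length-reverse (h ∷ w)))) ⟩
    at (reverse (h ∷ w)) (length w)
      ≡⟨ at-reverse-last h w ⟩
    h ∎

-- Reflecting the path from a head in the set keeps the spider independent: the
-- reflected path is independent by symmetry, the other legs since they avoid the head.
reflectLeg-indep : ∀ L₁ l L₂ {xs} → LegSplit (sum L₁) l (sum L₂) xs → T (at xs 0) →
  T (edgesIndep (at xs) (spiderEdgesFrom 1 (L₁ ++ l ∷ L₂))) →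
  T (edgesIndep (at (reflectLeg (sum L₁) l xs)) (spiderEdgesFrom 1 (L₁ ++ l ∷ L₂)))
reflectLeg-indep L₁ l L₂ (legSplit (true ∷ w) v₁ v₂ len₁ len-p len₂) _ indep
  rewrite sym len₁ | reflectLeg-withLeg (true ∷ w) v₁ v₂ len-p
  with reverse (true ∷ w) | pathIndep-reverse (true ∷ w) | length-reverse (true ∷ w)
... | h′ ∷ w′ | reflected-path | len-reflected =
  subst T (sym (spider-indep-split L₁ l L₂ h′ v₁ w′ v₂ len₁ len-w′ len₂))
    (Equivalence.from T-∧ (legsIndep-head-mono h′ L₁ v₁ legs₁ ,
      Equivalence.from T-∧ (subst T (sym reflected-path) path , legsIndep-head-mono h′ L₂ v₂ legs₂)))
  where
  len-w′ : length w′ ≡ l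
  len-w′ = suc-injective (trans len-reflected len-p)
  parts : T (legsIndep true L₁ v₁) × T (pathIndep (true ∷ w) ∧ legsIndep true L₂ v₂)
  parts = Equivalence.to T-∧ (subst T (spider-indep-split L₁ l L₂ true v₁ w v₂ len₁ (suc-injective len-p) len₂) indep)
  legs₁ : T (legsIndep true L₁ v₁)
  legs₁ = proj₁ parts
  path : T (pathIndep (true ∷ w))
  path = proj₁ (Equivalence.to T-∧ (proj₂ parts))
  legs₂ : T (legsIndep true L₂ v₂)
  legs₂ = proj₂ (Equivalence.to T-∧ (proj₂ parts))

module LegReflection (L₁ : List ℕ) (l : ℕ) (L₂ : List ℕ) where

  private
    L = L₁ ++ l ∷ L₂
    G = spider L

  bits-split : (S : Subset (order G)) → LegSplit (sum L₁) l (sum L₂) (toList S)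
  bits-split S = legSplit? (sum L₁) l (sum L₂) (toList S) (trans (length-toList S) (cong suc (sum-++ L₁ (l ∷ L₂))))

  reflect : Subset (order G) → Subset (order G)
  reflect S = cast (trans (reflectLeg-length (bits-split S)) (length-toList S)) (fromList (reflectLeg (sum L₁) l (toList S)))

  toList-reflect : ∀ S → toList (reflect S) ≡ reflectLeg (sum L₁) l (toList S)
  toList-reflect S = trans (toList-cast _ _) (toList∘fromList _)

  reflect-injective : ∀ {S S′} → reflect S ≡ reflect S′ → S ≡ S′
  reflect-injective {S} {S′} eq = begin
    S                   ≡⟨ sym (reflect-involutive S) ⟩
    reflect (reflect S) ≡⟨ cong reflect eq ⟩
    reflect (reflect S′) ≡⟨ reflect-involutive S′ ⟩
    S′ ∎
    where
    reflect-involutive : ∀ S → reflect (reflect S) ≡ S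
    reflect-involutive S = toList-injective′ (begin
      toList (reflect (reflect S))                       ≡⟨ toList-reflect (reflect S) ⟩
      reflectLeg (sum L₁) l (toList (reflect S))         ≡⟨ cong (reflectLeg (sum L₁) l) (toList-reflect S) ⟩
      reflectLeg (sum L₁) l (reflectLeg (sum L₁) l (toList S)) ≡⟨ reflectLeg-involutive (bits-split S) ⟩
      toList S                                           ∎)

  reflect-star : 0 < l → ∀ (end : Fin (order G)) → toℕ end ≡ sum L₁ + l →
    ∀ S → T (isIndependent G S) → T (memℕ 0 S) →
    T (isIndependent G (reflect S)) × ∣ reflect S ∣ ≡ ∣ S ∣ × T (memℕ (toℕ end) (reflect S))
  reflect-star 0<l end end-index S indep head∈S = reflect-indep , reflect-size , end∈reflect
    where
    head-bit : T (at (toList S) 0)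
    head-bit = subst T (memℕ-toList 0 S) head∈S

    reflect-indep : T (isIndependent G (reflect S))
    reflect-indep =
      subst T (sym (trans (isIndependent-toList G (reflect S)) (cong (λ xs → edgesIndep (at xs) (edges G)) (toList-reflect S))))
        (reflectLeg-indep L₁ l L₂ (bits-split S) head-bit (subst T (isIndependent-toList G S) indep))

    reflect-size : ∣ reflect S ∣ ≡ ∣ S ∣
    reflect-size = begin
      ∣ reflect S ∣                            ≡⟨ ∣∣-toList (reflect S) ⟩
      trues (toList (reflect S))               ≡⟨ cong trues (toList-reflect S) ⟩
      trues (reflectLeg (sum L₁) l (toList S)) ≡⟨ reflectLeg-trues (bits-split S) ⟩
      trues (toList S)                         ≡⟨ sym (∣∣-toList S) ⟩
      ∣ S ∣                                    ∎

    end∈reflect : T (memℕ (toℕ end) (reflect S))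
    end∈reflect = subst T (sym (begin
      memℕ (toℕ end) (reflect S)                         ≡⟨ memℕ-toList (toℕ end) (reflect S) ⟩
      at (toList (reflect S)) (toℕ end)                  ≡⟨ cong₂ at (toList-reflect S) end-index ⟩
      at (reflectLeg (sum L₁) l (toList S)) (sum L₁ + l) ≡⟨ reflectLeg-end (bits-split S) 0<l ⟩
      at (toList S) 0                                    ∎)) head-bit

  star-head≤star-end : 0 < l → ∀ t (end : Fin (order G)) → toℕ end ≡ sum L₁ + l →
    length (𝓘[ G ] t at spiderHead L) ≤ length (𝓘[ G ] t at end)
  star-head≤star-end 0<l t end end-index =
    star-≤ G t (spiderHead L) end reflect reflect-injective (reflect-star 0<l end end-index)

leg-decomposition : ∀ (L : List ℕ) (i : Fin (length L)) → L ≡ take (toℕ i) L ++ lookup L i ∷ drop (suc (toℕ i)) L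
leg-decomposition (_ ∷ L) Fin.zero    = refl
leg-decomposition (x ∷ L) (Fin.suc i) = cong (x ∷_) (leg-decomposition L i)

legEndIndex-lookup : ∀ (L : List ℕ) (i : Fin (length L)) → legEndIndex L (toℕ i) ≡ sum (take (toℕ i) L) + lookup L i
legEndIndex-lookup L i = begin
  sum (take (suc (toℕ i)) L)                       ≡⟨ cong sum (take-suc L i) ⟩
  sum (take (toℕ i) L ++ [ lookup L i ])           ≡⟨ sum-++ (take (toℕ i) L) [ lookup L i ] ⟩
  sum (take (toℕ i) L) + (lookup L i + 0)          ≡⟨ cong (sum (take (toℕ i) L) +_) (+-identityʳ (lookup L i)) ⟩
  sum (take (toℕ i) L) + lookup L i                ∎

star-head≤star-leg-end : ∀ {L L₁ l L₂} → L ≡ L₁ ++ l ∷ L₂ → 0 < l → ∀ t (end : Fin (order (spider L))) →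
  toℕ end ≡ sum L₁ + l → length (𝓘[ spider L ] t at spiderHead L) ≤ length (𝓘[ spider L ] t at end)
star-head≤star-leg-end {L₁ = L₁} {l} {L₂} refl = LegReflection.star-head≤star-end L₁ l L₂

-- The star at the head is no larger than the star at the end of any leg.
theorem2 : (L : List ℕ) → 1 ≤ length L → All (λ l → 1 ≤ l) L →
    (t : ℕ) → t ≤ α (spider L) →
    (i : Fin (length L)) (tip : Fin (order (spider L))) →
    toℕ tip ≡ legEndIndex L (toℕ i) →
    length (𝓘[ spider L ] t at spiderHead L) ≤ length (𝓘[ spider L ] t at tip)
theorem2 L _ legs-positive t _ i tip tip-index =
  star-head≤star-leg-end (leg-decomposition L i) (All.lookup legs-positive (∈-lookup i)) t tip
    (trans tip-index (legEndIndex-lookup L i))
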